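{- Let $d\ge2$ and let $B\in\mathbb Z^{d\times d}$ with $D=|\det B|\ge1$, whose columns span the simplicial full-dimensional cone $B\mathbb R^d_+$. Let $C\in\mathbb Z_+$ be such that $|B_{i,j}|\le C$ for all $i,j$. Then every basis matrix $\bar B$ of a cone that appears in the recursive signed decomposition procedure of Barvinok's algorithm applied to $B\mathbb R^d_+$ has all entries bounded in absolute value by $d^{k(D)}C$, where $$k(D)=\Bigl\lfloor 1+\frac{\log_2\log_2 D}{\log_2\frac{d}{d-1}}\Bigr\rfloor.$$
   Context: Barvinok's signed decomposition procedure: given a simplicial full-dimensional cone spanned by the columns $\mathbf b_1,\dots,\mathbf b_d\in\mathbb Z^d$ of a matrix $B$ with $|\det B|>1$, one constructs a vector $\mathbf w\in\mathbb Z^d$ with $\mathbf w=\alpha_1\mathbf b_1+\dots+\alpha_d\mathbf b_d$ and $|\alpha_i|\le|\det B|^{ -1/d}\le 1$ for all $i$, and decomposes the cone (with signs, via inclusion–exclusion) into the cones spanned by $d$ vectors from $\{\mathbf b_1,\dots,\mathbf b_d,\mathbf w\}$; each of the resulting full-dimensional cones has $|\det|$ at most $|\det B|^{(d-1)/d}$. The procedure is applied recursively to the resulting cones, forming a decomposition tree. It is a known result of Barvinok that, starting from a cone with basis matrix of absolute determinant $D$, the depth of this decomposition tree is at most $k(D)$. -}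

module Defs where

open import Data.Nat as ℕ using (ℕ; zero; suc)
open import Data.Integer as ℤ using (ℤ; +_; -_)
open import Data.Rational as ℚ using (ℚ)
open import Data.Fin using (Fin; zero; suc; toℕ; punchIn; _≟_)
open import Data.Product using (Σ; _×_)
open import Relation.Nullary using (¬_; yes; no)
open import Relation.Binary.PropositionalEquality using (_≡_)

-- d × d integer matrices: B i j = entry in row i, column j.
Matrix : ℕ → Set
Matrix d = Fin d → Fin d → ℤ

sumℤ : ∀ {n} → (Fin n → ℤ) → ℤ
sumℤ {zero}  f = + 0
sumℤ {suc n} f = f zero ℤ.+ sumℤ (λ j → f (suc j))

sumℚ : ∀ {n} → (Fin n → ℚ) → ℚ
sumℚ {zero}  f = ℚ.0ℚ
sumℚ {suc n} f = f zero ℚ.+ sumℚ (λ j → f (suc j))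

signℤ : ℕ → ℤ
signℤ zero = + 1
signℤ (suc k) = - signℤ k

det : ∀ {n} → Matrix n → ℤ
det {zero}  M = + 1
det {suc n} M =
  sumℤ (λ j → signℤ (toℕ j) ℤ.* (M zero j ℤ.* det (λ r c → M (suc r) (punchIn j c))))

_^ℚ_ : ℚ → ℕ → ℚ
q ^ℚ zero = ℚ.1ℚ
q ^ℚ suc k = q ℚ.* (q ^ℚ k)

toℚ : ℤ → ℚ
toℚ z = z ℚ./ 1

-- w is a Barvinok short vector for B: w ∈ ℤ^d, w = α₁b₁ + … + α_d b_d
-- (b_j = j-th column of B) with |α_i| ≤ |det B|^(-1/d) for all i,
-- the latter written without real roots as |α_i|^d · |det B| ≤ 1.
IsBarvinokVector : ∀ {d} → Matrix d → (Fin d → ℤ) → Set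
IsBarvinokVector {d} B w =
  Σ (Fin d → ℚ) λ α →
    (∀ i → toℚ (w i) ≡ sumℚ (λ j → toℚ (B i j) ℚ.* α j)) ×
    (∀ i → (ℚ.∣ α i ∣ ^ℚ d) ℚ.* toℚ (+ ℤ.∣ det B ∣) ℚ.≤ ℚ.1ℚ)

replaceCol : ∀ {d} → Matrix d → Fin d → (Fin d → ℤ) → Matrix d
replaceCol B k w i j with j ≟ k
... | yes _ = w i
... | no  _ = B i j

-- Appears B B̄ : B̄ is the basis matrix of a cone occurring in the recursive
-- signed decomposition tree of Barvinok's algorithm started at B.
-- A node B with |det B| > 1 is decomposed, using a Barvinok vector w, into the
-- full-dimensional cones spanned by d vectors from {b₁,…,b_d,w}, i.e. B with one
-- column b_k replaced by w (det ≠ 0); lower-dimensional cones are dropped.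
data Appears {d : ℕ} (B : Matrix d) : Matrix d → Set where
  root : Appears B B
  step : ∀ {B̄} (w : Fin d → ℤ) (k : Fin d) →
         1 ℕ.< ℤ.∣ det B ∣ →
         IsBarvinokVector B w →
         ¬ (det (replaceCol B k w) ≡ + 0) →
         Appears (replaceCol B k w) B̄ →
         Appears B B̄

-- IsKD d D k  :  k = k(D) = ⌊1 + log₂ log₂ D / log₂ (d/(d-1))⌋.
-- For D ≥ 2 and k ≥ 1:  k ≤ 1 + log₂log₂D / log₂(d/(d-1))
--   ⟺ (d/(d-1))^(k-1) ≤ log₂ D ⟺ 2^(d^(k-1)) ≤ D^((d-1)^(k-1)),
-- and k + 1 > 1 + … ⟺ D^((d-1)^k) < 2^(d^k).
-- For D = 1 this gives k = 0 (the natural convention: no decomposition occurs).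
IsKD : ℕ → ℕ → ℕ → Set
IsKD d D k =
  (1 ℕ.≤ k → 2 ℕ.^ (d ℕ.^ (k ℕ.∸ 1)) ℕ.≤ D ℕ.^ ((d ℕ.∸ 1) ℕ.^ (k ℕ.∸ 1))) ×
  (D ℕ.^ ((d ℕ.∸ 1) ℕ.^ k) ℕ.< 2 ℕ.^ (d ℕ.^ k))

-- Replacing column k of B by a Barvinok vector w = Bα multiplies the determinant by α_k
-- (Cramer's rule), so from |α_k|^d |det B| ≤ 1 the absolute determinants D = D₀, D₁, … along a
-- branch of the tree satisfy D_{m+1}^d ≤ D_m^(d-1), that is D_m^(dᵐ) ≤ D^((d-1)ᵐ). A node is
-- only split when D_m ≥ 2, and then this inequality forces m < k(D). Moreover |α_i| ≤ 1, so the
-- entries of w are at most d times the largest entry of B, and by induction the entries of every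
-- matrix at depth m ≤ k(D) are at most dᵐC.

module Submission where

open import Data.Nat as ℕ using (ℕ; zero; suc)
open import Data.Fin using (Fin; zero; suc; toℕ; punchIn; punchOut; inject₁; _≟_)
open import Data.Product using (_×_; _,_)
open import Data.Sum using (_⊎_; inj₁; inj₂)
open import Data.Empty using (⊥-elim)
open import Relation.Nullary using (Dec; yes; no)
open import Relation.Binary.PropositionalEquality
import Data.Nat.Properties as ℕP
open import Defs

module Determinant where
  open import Data.Rational using (ℚ; _+_; _*_; -_; 0ℚ; 1ℚ)
  import Data.Rational.Properties as ℚP
  open import Data.Rational.Solver using (module +-*-Solver)
  open +-*-Solver using (solve; _:=_; _:+_; _:*_; :-_; con)
  open import Data.Fin.Properties
    using (punchIn-injective; punchIn-punchOut; punchInᵢ≢i; toℕ-injective; toℕ-inject₁; suc-injective)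
  open import Relation.Binary.Definitions using (tri<; tri≈; tri>)
  open ≡-Reasoning

  sumℚ-cong : ∀ {n} {f g : Fin n → ℚ} → (∀ i → f i ≡ g i) → sumℚ f ≡ sumℚ g
  sumℚ-cong {zero}  f≗g = refl
  sumℚ-cong {suc n} f≗g = cong₂ _+_ (f≗g zero) (sumℚ-cong (λ i → f≗g (suc i)))

  sumℚ-zero : ∀ {n} {f : Fin n → ℚ} → (∀ i → f i ≡ 0ℚ) → sumℚ f ≡ 0ℚ
  sumℚ-zero {zero}  f≗0 = refl
  sumℚ-zero {suc n} f≗0 = cong₂ _+_ (f≗0 zero) (sumℚ-zero (λ i → f≗0 (suc i)))

  sumℚ-linear : ∀ {n} (a b : ℚ) (f g : Fin n → ℚ) →
    sumℚ (λ i → a * f i + b * g i) ≡ a * sumℚ f + b * sumℚ g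
  sumℚ-linear {zero} a b f g =
    solve 2 (λ a b → con 0ℚ := a :* con 0ℚ :+ b :* con 0ℚ) refl a b
  sumℚ-linear {suc n} a b f g = begin
    (a * f zero + b * g zero) + sumℚ (λ i → a * f (suc i) + b * g (suc i))
      ≡⟨ cong ((a * f zero + b * g zero) +_) (sumℚ-linear a b (λ i → f (suc i)) (λ i → g (suc i))) ⟩
    (a * f zero + b * g zero) + (a * F + b * G)
      ≡⟨ solve 6 (λ a b x y u v → (a :* x :+ b :* y) :+ (a :* u :+ b :* v) := a :* (x :+ u) :+ b :* (y :+ v))
           refl a b (f zero) (g zero) F G ⟩
    a * (f zero + F) + b * (g zero + G) ∎
    where
    F = sumℚ (λ i → f (suc i))
    G = sumℚ (λ i → g (suc i))

  sumℚ-single : ∀ {n} (f : Fin n → ℚ) k → (∀ t → t ≢ k → f t ≡ 0ℚ) → sumℚ f ≡ f k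
  sumℚ-single f zero f≗0 = begin
    f zero + sumℚ (λ t → f (suc t)) ≡⟨ cong (f zero +_) (sumℚ-zero (λ t → f≗0 (suc t) (λ ()))) ⟩
    f zero + 0ℚ                     ≡⟨ ℚP.+-identityʳ (f zero) ⟩
    f zero                          ∎
  sumℚ-single f (suc k) f≗0 = begin
    f zero + sumℚ (λ t → f (suc t)) ≡⟨ cong (_+ sumℚ (λ t → f (suc t))) (f≗0 zero (λ ())) ⟩
    0ℚ + sumℚ (λ t → f (suc t))     ≡⟨ ℚP.+-identityˡ _ ⟩
    sumℚ (λ t → f (suc t))          ≡⟨ sumℚ-single (λ t → f (suc t)) k (λ t t≢k → f≗0 (suc t) (λ e → t≢k (suc-injective e))) ⟩
    f (suc k)                       ∎

  MatrixQ : ℕ → Set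
  MatrixQ n = Fin n → Fin n → ℚ

  column : ∀ {n} → MatrixQ n → Fin n → Fin n → ℚ
  column M j r = M r j

  signQ : ℕ → ℚ
  signQ zero    = 1ℚ
  signQ (suc k) = - signQ k

  minor : ∀ {n} → MatrixQ (suc n) → Fin (suc n) → MatrixQ n
  minor M l r c = M (suc r) (punchIn l c)

  detQ : ∀ {n} → MatrixQ n → ℚ
  detQ {zero}  M = 1ℚ
  detQ {suc n} M = sumℚ (λ l → signQ (toℕ l) * (M zero l * detQ (minor M l)))

  setColumn : ∀ {n} → MatrixQ n → Fin n → (Fin n → ℚ) → MatrixQ n
  setColumn M k v r j with j ≟ k
  ... | yes _ = v r
  ... | no  _ = M r j

  setColumn-same : ∀ {n} (M : MatrixQ n) k v r {j} → j ≡ k → setColumn M k v r j ≡ v r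
  setColumn-same M k v r {j} j≡k with j ≟ k
  ... | yes _   = refl
  ... | no j≢k = ⊥-elim (j≢k j≡k)

  setColumn-other : ∀ {n} (M : MatrixQ n) k v r {j} → j ≢ k → setColumn M k v r j ≡ M r j
  setColumn-other M k v r {j} j≢k with j ≟ k
  ... | yes j≡k = ⊥-elim (j≢k j≡k)
  ... | no  _   = refl

  setColumn-cong : ∀ {n} (M : MatrixQ n) k {u v} → (∀ r → u r ≡ v r) → ∀ r j →
    setColumn M k u r j ≡ setColumn M k v r j
  setColumn-cong M k u≗v r j with j ≟ k
  ... | yes _ = u≗v r
  ... | no  _ = refl

  setColumn-restore : ∀ {n} {X M : MatrixQ n} k → (∀ r l → X r l ≡ M r l) → ∀ r l →
    setColumn X k (column M k) r l ≡ M r l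
  setColumn-restore k X≗M r l with l ≟ k
  ... | yes refl = refl
  ... | no  _    = X≗M r l

  setColumn-comm : ∀ {n} (M : MatrixQ n) {i j} u v → i ≢ j → ∀ r l →
    setColumn (setColumn M i u) j v r l ≡ setColumn (setColumn M j v) i u r l
  setColumn-comm M {i} {j} u v i≢j r l = by-cases (l ≟ i) (l ≟ j)
    where
    by-cases : Dec (l ≡ i) → Dec (l ≡ j) →
      setColumn (setColumn M i u) j v r l ≡ setColumn (setColumn M j v) i u r l
    by-cases (yes l≡i) (yes l≡j) = ⊥-elim (i≢j (trans (sym l≡i) l≡j))
    by-cases (yes l≡i) (no l≢j) = begin
      setColumn (setColumn M i u) j v r l ≡⟨ setColumn-other _ j v r l≢j ⟩
      setColumn M i u r l                 ≡⟨ setColumn-same M i u r l≡i ⟩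
      u r                                 ≡⟨ setColumn-same _ i u r l≡i ⟨
      setColumn (setColumn M j v) i u r l ∎
    by-cases (no l≢i) (yes l≡j) = begin
      setColumn (setColumn M i u) j v r l ≡⟨ setColumn-same _ j v r l≡j ⟩
      v r                                 ≡⟨ setColumn-same M j v r l≡j ⟨
      setColumn M j v r l                 ≡⟨ setColumn-other _ i u r l≢i ⟨
      setColumn (setColumn M j v) i u r l ∎
    by-cases (no l≢i) (no l≢j) = begin
      setColumn (setColumn M i u) j v r l ≡⟨ setColumn-other _ j v r l≢j ⟩
      setColumn M i u r l                 ≡⟨ setColumn-other M i u r l≢i ⟩
      M r l                               ≡⟨ setColumn-other M j v r l≢j ⟨
      setColumn M j v r l                 ≡⟨ setColumn-other _ i u r l≢i ⟨
      setColumn (setColumn M j v) i u r l ∎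

  detQ-cong : ∀ {n} {M N : MatrixQ n} → (∀ r c → M r c ≡ N r c) → detQ M ≡ detQ N
  detQ-cong {zero}  M≗N = refl
  detQ-cong {suc n} M≗N = sumℚ-cong (λ l →
    cong₂ (λ x y → signQ (toℕ l) * (x * y)) (M≗N zero l) (detQ-cong (λ r c → M≗N (suc r) (punchIn l c))))

  detQ-linear : ∀ {n} (M N P : MatrixQ n) c (a b : ℚ) →
    (∀ r → P r c ≡ a * M r c + b * N r c) →
    (∀ r {j} → j ≢ c → P r j ≡ M r j) → (∀ r {j} → j ≢ c → P r j ≡ N r j) →
    detQ P ≡ a * detQ M + b * detQ N
  detQ-linear {suc n} M N P c a b Pc P≗M P≗N =
    trans (sumℚ-cong term) (sumℚ-linear a b (term-of M) (term-of N))
    where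
    term-of : MatrixQ (suc n) → Fin (suc n) → ℚ
    term-of X l = signQ (toℕ l) * (X zero l * detQ (minor X l))

    term : ∀ l → term-of P l ≡ a * term-of M l + b * term-of N l
    term l with l ≟ c
    ... | yes refl = begin
      s * (P zero l * detQ (minor P l))                  ≡⟨ cong₂ (λ x y → s * (x * y)) (Pc zero) dP≡dM ⟩
      s * ((a * M zero l + b * N zero l) * detQ (minor M l))
        ≡⟨ solve 6 (λ s a b x y d → s :* ((a :* x :+ b :* y) :* d) := a :* (s :* (x :* d)) :+ b :* (s :* (y :* d)))
             refl s a b (M zero l) (N zero l) (detQ (minor M l)) ⟩
      a * term-of M l + b * (s * (N zero l * detQ (minor M l))) ≡⟨ cong (λ y → a * term-of M l + b * (s * (N zero l * y))) dM≡dN ⟩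
      a * term-of M l + b * term-of N l                  ∎
      where
      s = signQ (toℕ l)
      -- the minors at column c do not see column c
      dP≡dM : detQ (minor P l) ≡ detQ (minor M l)
      dP≡dM = detQ-cong (λ r c′ → P≗M (suc r) (punchInᵢ≢i l c′))
      dM≡dN : detQ (minor M l) ≡ detQ (minor N l)
      dM≡dN = trans (sym dP≡dM) (detQ-cong (λ r c′ → P≗N (suc r) (punchInᵢ≢i l c′)))
    ... | no l≢c = begin
      s * (P zero l * detQ (minor P l))                            ≡⟨ cong₂ (λ x y → s * (x * y)) (P≗M zero l≢c) minor-linear ⟩
      s * (M zero l * (a * detQ (minor M l) + b * detQ (minor N l)))
        ≡⟨ solve 6 (λ s x a b u v → s :* (x :* (a :* u :+ b :* v)) := a :* (s :* (x :* u)) :+ b :* (s :* (x :* v)))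
             refl s (M zero l) a b (detQ (minor M l)) (detQ (minor N l)) ⟩
      a * term-of M l + b * (s * (M zero l * detQ (minor N l)))  ≡⟨ cong (λ x → a * term-of M l + b * (s * (x * detQ (minor N l))))
                                                                      (trans (sym (P≗M zero l≢c)) (P≗N zero l≢c)) ⟩
      a * term-of M l + b * term-of N l                          ∎
      where
      s = signQ (toℕ l)
      c′ = punchOut l≢c
      c′↦c : punchIn l c′ ≡ c
      c′↦c = punchIn-punchOut l≢c
      avoids-c : ∀ {j} → j ≢ c′ → punchIn l j ≢ c
      avoids-c j≢c′ e = j≢c′ (punchIn-injective l _ c′ (trans e (sym c′↦c)))
      minor-linear : detQ (minor P l) ≡ a * detQ (minor M l) + b * detQ (minor N l)
      minor-linear = detQ-linear (minor M l) (minor N l) (minor P l) c′ a b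
        (λ r → subst (λ x → P (suc r) x ≡ a * M (suc r) x + b * N (suc r) x) (sym c′↦c) (Pc (suc r)))
        (λ r j≢c′ → P≗M (suc r) (avoids-c j≢c′))
        (λ r j≢c′ → P≗N (suc r) (avoids-c j≢c′))

  detQ-setColumn-+ : ∀ {n} (M : MatrixQ n) c (u v : Fin n → ℚ) →
    detQ (setColumn M c (λ r → u r + v r)) ≡ detQ (setColumn M c u) + detQ (setColumn M c v)
  detQ-setColumn-+ M c u v = trans
    (detQ-linear (setColumn M c u) (setColumn M c v) (setColumn M c (λ r → u r + v r)) c 1ℚ 1ℚ
      (λ r → begin
        setColumn M c (λ r → u r + v r) r c ≡⟨ setColumn-same M c _ r refl ⟩
        u r + v r                           ≡⟨ cong₂ _+_ (ℚP.*-identityˡ (u r)) (ℚP.*-identityˡ (v r)) ⟨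
        1ℚ * u r + 1ℚ * v r                 ≡⟨ cong₂ (λ x y → 1ℚ * x + 1ℚ * y) (setColumn-same M c u r refl) (setColumn-same M c v r refl) ⟨
        1ℚ * setColumn M c u r c + 1ℚ * setColumn M c v r c ∎)
      (λ r j≢c → trans (setColumn-other M c _ r j≢c) (sym (setColumn-other M c u r j≢c)))
      (λ r j≢c → trans (setColumn-other M c _ r j≢c) (sym (setColumn-other M c v r j≢c))))
    (cong₂ _+_ (ℚP.*-identityˡ (detQ (setColumn M c u))) (ℚP.*-identityˡ (detQ (setColumn M c v))))

  detQ-setColumn-*ʳ : ∀ {n} (M : MatrixQ n) c (u : Fin n → ℚ) a →
    detQ (setColumn M c (λ r → u r * a)) ≡ a * detQ (setColumn M c u)
  detQ-setColumn-*ʳ M c u a = trans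
    (detQ-linear U U (setColumn M c (λ r → u r * a)) c a 0ℚ
      (λ r → begin
        setColumn M c (λ r → u r * a) r c ≡⟨ setColumn-same M c _ r refl ⟩
        u r * a                           ≡⟨ solve 2 (λ x a → x :* a := a :* x :+ con 0ℚ :* x) refl (u r) a ⟩
        a * u r + 0ℚ * u r                ≡⟨ cong (λ x → a * x + 0ℚ * x) (setColumn-same M c u r refl) ⟨
        a * U r c + 0ℚ * U r c            ∎)
      agree agree)
    (solve 2 (λ a d → a :* d :+ con 0ℚ :* d := a :* d) refl a (detQ U))
    where
    U = setColumn M c u
    agree : ∀ r {j} → j ≢ c → setColumn M c (λ r → u r * a) r j ≡ U r j
    agree r j≢c = trans (setColumn-other M c _ r j≢c) (sym (setColumn-other M c u r j≢c))

  detQ-zero-column : ∀ {n} (M : MatrixQ n) c → detQ (setColumn M c (λ _ → 0ℚ)) ≡ 0ℚ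
  detQ-zero-column M c = begin
    detQ (setColumn M c (λ _ → 0ℚ))                  ≡⟨ detQ-cong (setColumn-cong M c (λ r → sym (ℚP.*-zeroʳ (M r c)))) ⟩
    detQ (setColumn M c (λ r → column M c r * 0ℚ))   ≡⟨ detQ-setColumn-*ʳ M c (column M c) 0ℚ ⟩
    0ℚ * detQ (setColumn M c (column M c))           ≡⟨ ℚP.*-zeroˡ (detQ (setColumn M c (column M c))) ⟩
    0ℚ                                               ∎

  data Adjacent : ∀ {n} → Fin n → Fin n → Set where
    zero-one : ∀ {n} → Adjacent {suc (suc n)} zero (suc zero)
    suc-suc  : ∀ {n} {i j : Fin n} → Adjacent i j → Adjacent (suc i) (suc j)

  adjacent-toℕ : ∀ {n} {i j : Fin n} → Adjacent i j → toℕ j ≡ suc (toℕ i)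
  adjacent-toℕ zero-one    = refl
  adjacent-toℕ (suc-suc a) = cong suc (adjacent-toℕ a)

  adjacent⇒≢ : ∀ {n} {i j : Fin n} → Adjacent i j → i ≢ j
  adjacent⇒≢ a i≡j = ℕP.1+n≢n (sym (trans (cong toℕ i≡j) (adjacent-toℕ a)))

  inject₁-adjacent : ∀ {n} (i : Fin n) → Adjacent (inject₁ i) (suc i)
  inject₁-adjacent zero    = zero-one
  inject₁-adjacent (suc i) = suc-suc (inject₁-adjacent i)

  adjacent-punchOut : ∀ {n} {i j l : Fin (suc n)} → Adjacent i j → (l≢i : l ≢ i) (l≢j : l ≢ j) →
    Adjacent (punchOut l≢i) (punchOut l≢j)
  adjacent-punchOut {zero} (suc-suc {i = ()} a) _ _
  adjacent-punchOut {suc n}       {l = zero}        zero-one l≢i _ = ⊥-elim (l≢i refl)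
  adjacent-punchOut {suc n}       {l = suc zero}    zero-one _ l≢j = ⊥-elim (l≢j refl)
  adjacent-punchOut {suc (suc n)} {l = suc (suc l)} zero-one _ _   = zero-one
  adjacent-punchOut {suc n}       {l = zero}        (suc-suc a) _ _ = a
  adjacent-punchOut {suc zero}    {l = suc l} (suc-suc {i = zero} {j = zero} a) _ _ = ⊥-elim (adjacent⇒≢ a refl)
  adjacent-punchOut {suc (suc n)} {l = suc l} (suc-suc a) l≢i l≢j =
    suc-suc (adjacent-punchOut a (λ e → l≢i (cong suc e)) (λ e → l≢j (cong suc e)))

  adjacent-punchIn : ∀ {n} {i j : Fin (suc n)} → Adjacent i j → ∀ c →
    (punchIn i c ≡ punchIn j c) ⊎ (punchIn i c ≡ j × punchIn j c ≡ i)
  adjacent-punchIn zero-one    zero    = inj₂ (refl , refl)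
  adjacent-punchIn zero-one    (suc c) = inj₁ refl
  adjacent-punchIn (suc-suc a) zero    = inj₁ refl
  adjacent-punchIn (suc-suc a) (suc c) with adjacent-punchIn a c
  ... | inj₁ e         = inj₁ (cong suc e)
  ... | inj₂ (e₁ , e₂) = inj₂ (cong suc e₁ , cong suc e₂)

  sumℚ-adjacent : ∀ {n} {i j : Fin n} (f : Fin n → ℚ) → Adjacent i j →
    (∀ l → l ≢ i → l ≢ j → f l ≡ 0ℚ) → f i + f j ≡ 0ℚ → sumℚ f ≡ 0ℚ
  sumℚ-adjacent f zero-one rest≗0 pair≡0 = begin
    f zero + (f (suc zero) + sumℚ (λ l → f (suc (suc l)))) ≡⟨ ℚP.+-assoc (f zero) (f (suc zero)) _ ⟨
    (f zero + f (suc zero)) + sumℚ (λ l → f (suc (suc l))) ≡⟨ cong₂ _+_ pair≡0 (sumℚ-zero (λ l → rest≗0 (suc (suc l)) (λ ()) (λ ()))) ⟩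
    0ℚ                                                     ∎
  sumℚ-adjacent f (suc-suc a) rest≗0 pair≡0 = begin
    f zero + sumℚ (λ l → f (suc l)) ≡⟨ cong₂ _+_ (rest≗0 zero (λ ()) (λ ())) (sumℚ-adjacent (λ l → f (suc l)) a
                                         (λ l l≢i l≢j → rest≗0 (suc l) (λ e → l≢i (suc-injective e)) (λ e → l≢j (suc-injective e)))
                                         pair≡0) ⟩
    0ℚ + 0ℚ                         ≡⟨ ℚP.+-identityˡ 0ℚ ⟩
    0ℚ                              ∎

  detQ-adjacent-equal : ∀ {n} (M : MatrixQ n) {i j : Fin n} → Adjacent i j →
    (∀ r → M r i ≡ M r j) → detQ M ≡ 0ℚ
  detQ-adjacent-equal {suc n} M {i} {j} a col-i≗col-j = sumℚ-adjacent term a others pair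
    where
    term : Fin (suc n) → ℚ
    term l = signQ (toℕ l) * (M zero l * detQ (minor M l))

    others : ∀ l → l ≢ i → l ≢ j → term l ≡ 0ℚ
    others l l≢i l≢j = begin
      signQ (toℕ l) * (M zero l * detQ (minor M l)) ≡⟨ cong (λ y → signQ (toℕ l) * (M zero l * y))
                                                         (detQ-adjacent-equal (minor M l) (adjacent-punchOut a l≢i l≢j) equal) ⟩
      signQ (toℕ l) * (M zero l * 0ℚ)               ≡⟨ solve 2 (λ s x → s :* (x :* con 0ℚ) := con 0ℚ) refl (signQ (toℕ l)) (M zero l) ⟩
      0ℚ                                            ∎
      where
      equal : ∀ r → minor M l r (punchOut l≢i) ≡ minor M l r (punchOut l≢j)
      equal r = begin
        M (suc r) (punchIn l (punchOut l≢i)) ≡⟨ cong (M (suc r)) (punchIn-punchOut l≢i) ⟩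
        M (suc r) i                          ≡⟨ col-i≗col-j (suc r) ⟩
        M (suc r) j                          ≡⟨ cong (M (suc r)) (punchIn-punchOut l≢j) ⟨
        M (suc r) (punchIn l (punchOut l≢j)) ∎

    same-minor : ∀ r c → minor M i r c ≡ minor M j r c
    same-minor r c with adjacent-punchIn a c
    ... | inj₁ e         = cong (M (suc r)) e
    ... | inj₂ (e₁ , e₂) = begin
      M (suc r) (punchIn i c) ≡⟨ cong (M (suc r)) e₁ ⟩
      M (suc r) j             ≡⟨ col-i≗col-j (suc r) ⟨
      M (suc r) i             ≡⟨ cong (M (suc r)) e₂ ⟨
      M (suc r) (punchIn j c) ∎

    -- the two terms carry opposite signs and otherwise agree
    pair : term i + term j ≡ 0ℚ
    pair rewrite adjacent-toℕ a | detQ-cong same-minor | col-i≗col-j zero =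
      solve 3 (λ s x d → s :* (x :* d) :+ (:- s) :* (x :* d) := con 0ℚ) refl
        (signQ (toℕ i)) (M zero j) (detQ (minor M j))

  detQ-adjacent-swap : ∀ {n} (M : MatrixQ n) {i j} → Adjacent i j →
    detQ (setColumn (setColumn M i (column M j)) j (column M i)) ≡ - detQ M
  detQ-adjacent-swap {n} M {i} {j} a = begin
    f v u                                              ≡⟨ solve 4 (λ a b c e → c := (a :+ b :+ (c :+ e)) :+ (:- a) :+ (:- e) :+ (:- b))
                                                            refl (f u u) (f u v) (f v u) (f v v) ⟩
    (f u u + f u v + (f v u + f v v)) + - f u u + - f v v + - f u v
      ≡⟨ cong₂ (λ x y → x + - y + - f v v + - f u v) expand (f-diagonal u) ⟩
    0ℚ + - 0ℚ + - f v v + - f u v                      ≡⟨ cong₂ (λ x y → 0ℚ + - 0ℚ + - x + - y) (f-diagonal v) f-unchanged ⟩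
    0ℚ + - 0ℚ + - 0ℚ + - detQ M                        ≡⟨ solve 1 (λ d → con 0ℚ :+ :- con 0ℚ :+ :- con 0ℚ :+ :- d := :- d) refl (detQ M) ⟩
    - detQ M                                           ∎
    where
    i≢j = adjacent⇒≢ a
    u = column M i
    v = column M j

    -- f is bilinear and vanishes on the diagonal, hence alternating
    f : (Fin n → ℚ) → (Fin n → ℚ) → ℚ
    f x y = detQ (setColumn (setColumn M i x) j y)

    f-diagonal : ∀ x → f x x ≡ 0ℚ
    f-diagonal x = detQ-adjacent-equal _ a (λ r → begin
      setColumn (setColumn M i x) j x r i ≡⟨ setColumn-other _ j x r i≢j ⟩
      setColumn M i x r i                 ≡⟨ setColumn-same M i x r refl ⟩
      x r                                 ≡⟨ setColumn-same _ j x r refl ⟨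
      setColumn (setColumn M i x) j x r j ∎)

    f-+ˡ : ∀ x x′ y → f (λ r → x r + x′ r) y ≡ f x y + f x′ y
    f-+ˡ x x′ y = begin
      f (λ r → x r + x′ r) y                          ≡⟨ detQ-cong (setColumn-comm M _ y i≢j) ⟩
      detQ (setColumn (setColumn M j y) i (λ r → x r + x′ r))
        ≡⟨ detQ-setColumn-+ _ i x x′ ⟩
      detQ (setColumn (setColumn M j y) i x) + detQ (setColumn (setColumn M j y) i x′)
        ≡⟨ cong₂ _+_ (detQ-cong (λ r l → sym (setColumn-comm M x y i≢j r l)))
                     (detQ-cong (λ r l → sym (setColumn-comm M x′ y i≢j r l))) ⟩
      f x y + f x′ y                                  ∎

    f-+ʳ : ∀ x y y′ → f x (λ r → y r + y′ r) ≡ f x y + f x y′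
    f-+ʳ x y y′ = detQ-setColumn-+ _ j y y′

    expand : f u u + f u v + (f v u + f v v) ≡ 0ℚ
    expand = begin
      f u u + f u v + (f v u + f v v)                   ≡⟨ cong₂ _+_ (f-+ʳ u u v) (f-+ʳ v u v) ⟨
      f u (λ r → u r + v r) + f v (λ r → u r + v r)     ≡⟨ f-+ˡ u v _ ⟨
      f (λ r → u r + v r) (λ r → u r + v r)             ≡⟨ f-diagonal _ ⟩
      0ℚ                                                ∎

    f-unchanged : f u v ≡ detQ M
    f-unchanged = detQ-cong (setColumn-restore j (setColumn-restore i (λ _ _ → refl)))

  detQ-equal-columns-apart : ∀ g {n} (M : MatrixQ n) {i j} → toℕ j ≡ suc (g ℕ.+ toℕ i) →
    (∀ r → M r i ≡ M r j) → detQ M ≡ 0ℚ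
  detQ-equal-columns-apart g       M {j = zero} () _
  detQ-equal-columns-apart zero    M {i} {suc j} j≡1+i col-i≗col-j =
    detQ-adjacent-equal M (subst (λ x → Adjacent x (suc j)) j↦i (inject₁-adjacent j)) col-i≗col-j
    where
    j↦i : inject₁ j ≡ i
    j↦i = toℕ-injective (trans (toℕ-inject₁ j) (ℕP.suc-injective j≡1+i))
  -- swapping column j with its left neighbour j′ brings the equal columns one step closer
  detQ-equal-columns-apart (suc g) M {i} {suc j} j≡2+g+i col-i≗col-j = begin
    detQ M         ≡⟨ solve 1 (λ x → :- (:- x) := x) refl (detQ M) ⟨
    - (- detQ M)   ≡⟨ cong -_ (detQ-adjacent-swap M (inject₁-adjacent j)) ⟨
    - detQ N       ≡⟨ cong -_ N-singular ⟩
    - 0ℚ           ≡⟨⟩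
    0ℚ             ∎
    where
    j′ = inject₁ j
    j′≡1+g+i : toℕ j′ ≡ suc (g ℕ.+ toℕ i)
    j′≡1+g+i = trans (toℕ-inject₁ j) (ℕP.suc-injective j≡2+g+i)
    N = setColumn (setColumn M j′ (column M (suc j))) (suc j) (column M j′)
    i≢j : i ≢ suc j
    i≢j e = ℕP.m≢1+n+m (toℕ i) (trans (cong toℕ e) j≡2+g+i)
    i≢j′ : i ≢ j′
    i≢j′ e = ℕP.m≢1+n+m (toℕ i) (trans (cong toℕ e) j′≡1+g+i)
    N-singular : detQ N ≡ 0ℚ
    N-singular = detQ-equal-columns-apart g N j′≡1+g+i (λ r → begin
      N r i                 ≡⟨ setColumn-other _ (suc j) _ r i≢j ⟩
      setColumn M j′ _ r i  ≡⟨ setColumn-other M j′ _ r i≢j′ ⟩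
      M r i                 ≡⟨ col-i≗col-j r ⟩
      M r (suc j)           ≡⟨ setColumn-same M j′ _ r refl ⟨
      setColumn M j′ _ r j′ ≡⟨ setColumn-other _ (suc j) _ r (adjacent⇒≢ (inject₁-adjacent j)) ⟨
      N r j′                ∎)

  detQ-equal-columns : ∀ {n} (M : MatrixQ n) {i j} → i ≢ j → (∀ r → M r i ≡ M r j) → detQ M ≡ 0ℚ
  detQ-equal-columns M {i} {j} i≢j col-i≗col-j with ℕP.<-cmp (toℕ i) (toℕ j)
  ... | tri< i<j _ _ = detQ-equal-columns-apart (toℕ j ℕ.∸ suc (toℕ i)) M
                         (trans (sym (ℕP.m+[n∸m]≡n i<j)) (cong suc (ℕP.+-comm (toℕ i) _))) col-i≗col-j
  ... | tri≈ _ i≡j _ = ⊥-elim (i≢j (toℕ-injective i≡j))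
  ... | tri> _ _ j<i = detQ-equal-columns-apart (toℕ i ℕ.∸ suc (toℕ j)) M
                         (trans (sym (ℕP.m+[n∸m]≡n j<i)) (cong suc (ℕP.+-comm (toℕ j) _))) (λ r → sym (col-i≗col-j r))

  detQ-setColumn-combination : ∀ {n m} (M : MatrixQ n) k (c : Fin m → Fin n → ℚ) (f : Fin m → ℚ) →
    detQ (setColumn M k (λ r → sumℚ (λ t → c t r * f t))) ≡ sumℚ (λ t → f t * detQ (setColumn M k (c t)))
  detQ-setColumn-combination {m = zero}  M k c f = detQ-zero-column M k
  detQ-setColumn-combination {m = suc m} M k c f = begin
    detQ (setColumn M k (λ r → c zero r * f zero + rest r))
      ≡⟨ detQ-setColumn-+ M k (λ r → c zero r * f zero) rest ⟩
    detQ (setColumn M k (λ r → c zero r * f zero)) + detQ (setColumn M k rest)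
      ≡⟨ cong₂ _+_ (detQ-setColumn-*ʳ M k (c zero) (f zero))
                   (detQ-setColumn-combination M k (λ t → c (suc t)) (λ t → f (suc t))) ⟩
    f zero * detQ (setColumn M k (c zero)) + sumℚ (λ t → f (suc t) * detQ (setColumn M k (c (suc t)))) ∎
    where
    rest : Fin _ → ℚ
    rest r = sumℚ (λ t → c (suc t) r * f (suc t))

  cramer : ∀ {n} (B : MatrixQ n) (α : Fin n → ℚ) k (w : Fin n → ℚ) →
    (∀ r → w r ≡ sumℚ (λ j → B r j * α j)) → detQ (setColumn B k w) ≡ α k * detQ B
  cramer B α k w w≡Bα = begin
    detQ (setColumn B k w)                                     ≡⟨ detQ-cong (setColumn-cong B k w≡Bα) ⟩
    detQ (setColumn B k (λ r → sumℚ (λ t → B r t * α t)))      ≡⟨ detQ-setColumn-combination B k (column B) α ⟩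
    sumℚ (λ t → α t * detQ (setColumn B k (column B t)))       ≡⟨ sumℚ-single _ k others-vanish ⟩
    α k * detQ (setColumn B k (column B k))                    ≡⟨ cong (α k *_) (detQ-cong (setColumn-restore k (λ _ _ → refl))) ⟩
    α k * detQ B                                               ∎
    where
    others-vanish : ∀ t → t ≢ k → α t * detQ (setColumn B k (column B t)) ≡ 0ℚ
    others-vanish t t≢k = begin
      α t * detQ (setColumn B k (column B t)) ≡⟨ cong (α t *_) (detQ-equal-columns _ (λ k≡t → t≢k (sym k≡t))
                                                   (λ r → trans (setColumn-same B k _ r refl) (sym (setColumn-other B k _ r t≢k)))) ⟩
      α t * 0ℚ                                ≡⟨ ℚP.*-zeroʳ (α t) ⟩
      0ℚ                                      ∎

module IntegerEmbedding where
  open Determinant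
  open import Data.Integer as ℤ using (ℤ; +_; -[1+_])
  import Data.Integer.Properties as ℤP
  open import Data.Integer.Solver using (module +-*-Solver)
  open import Data.Rational as ℚ using (ℚ; mkℚ; _+_; _*_; -_; _≤_)
  import Data.Rational.Properties as ℚP
  import Data.Rational.Unnormalised as ℚᵘ
  import Data.Rational.Unnormalised.Properties as ℚᵘP
  open import Data.Nat.Coprimality using (1-coprimeTo) renaming (sym to coprime-sym)

  -- toℚ z is the normalisation of z / 1; ι is its normal form, on which the ring laws
  -- reduce to integer identities.
  private
    ι : ℤ → ℚ
    ι z = mkℚ z 0 (coprime-sym (1-coprimeTo _))

    toℚ≡ι : ∀ z → toℚ z ≡ ι z
    toℚ≡ι (+ n)    = ℚP.normalize-coprime {n} {0} (coprime-sym (1-coprimeTo _))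
    toℚ≡ι -[1+ n ] = cong -_ (ℚP.normalize-coprime {suc n} {0} (coprime-sym (1-coprimeTo _)))

    ι-+ : ∀ a b → ι (a ℤ.+ b) ≡ ι a + ι b
    ι-+ a b = ℚP.toℚᵘ-injective (ℚᵘP.≃-sym (ℚᵘP.≃-trans (ℚP.toℚᵘ-homo-+ (ι a) (ι b))
      (ℚᵘ.*≡* (solve 2 (λ a b → (a :* con (+ 1) :+ b :* con (+ 1)) :* con (+ 1) := (a :+ b) :* (con (+ 1) :* con (+ 1)))
                 refl a b))))
      where open +-*-Solver

    ι-* : ∀ a b → ι (a ℤ.* b) ≡ ι a * ι b
    ι-* a b = ℚP.toℚᵘ-injective (ℚᵘP.≃-sym (ℚᵘP.≃-trans (ℚP.toℚᵘ-homo-* (ι a) (ι b))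
      (ℚᵘ.*≡* (solve 2 (λ a b → (a :* b) :* con (+ 1) := (a :* b) :* (con (+ 1) :* con (+ 1))) refl a b))))
      where open +-*-Solver

    ι-neg : ∀ a → ι (ℤ.- a) ≡ - ι a
    ι-neg (+ zero)  = refl
    ι-neg (+ suc n) = refl
    ι-neg -[1+ n ]  = refl

    ι-mono-≤ : ∀ {a b} → a ℤ.≤ b → ι a ≤ ι b
    ι-mono-≤ {a} {b} a≤b = ℚ.*≤* (subst₂ ℤ._≤_ (sym (ℤP.*-identityʳ a)) (sym (ℤP.*-identityʳ b)) a≤b)

    ι-cancel-≤ : ∀ {a b} → ι a ≤ ι b → a ℤ.≤ b
    ι-cancel-≤ {a} {b} (ℚ.*≤* a*1≤b*1) = subst₂ ℤ._≤_ (ℤP.*-identityʳ a) (ℤP.*-identityʳ b) a*1≤b*1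

  toℚ-+ : ∀ a b → toℚ (a ℤ.+ b) ≡ toℚ a + toℚ b
  toℚ-+ a b = trans (toℚ≡ι (a ℤ.+ b)) (trans (ι-+ a b) (sym (cong₂ _+_ (toℚ≡ι a) (toℚ≡ι b))))

  toℚ-* : ∀ a b → toℚ (a ℤ.* b) ≡ toℚ a * toℚ b
  toℚ-* a b = trans (toℚ≡ι (a ℤ.* b)) (trans (ι-* a b) (sym (cong₂ _*_ (toℚ≡ι a) (toℚ≡ι b))))

  toℚ-neg : ∀ a → toℚ (ℤ.- a) ≡ - toℚ a
  toℚ-neg a = trans (toℚ≡ι (ℤ.- a)) (trans (ι-neg a) (cong -_ (sym (toℚ≡ι a))))

  toℚ-∣∣ : ∀ a → ℚ.∣ toℚ a ∣ ≡ toℚ (+ ℤ.∣ a ∣)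
  toℚ-∣∣ a = trans (cong ℚ.∣_∣ (toℚ≡ι a)) (sym (toℚ≡ι (+ ℤ.∣ a ∣)))

  toℚ-mono-≤ : ∀ {a b} → a ℤ.≤ b → toℚ a ≤ toℚ b
  toℚ-mono-≤ {a} {b} a≤b = subst₂ _≤_ (sym (toℚ≡ι a)) (sym (toℚ≡ι b)) (ι-mono-≤ a≤b)

  toℚ-cancel-≤ : ∀ {a b} → toℚ a ≤ toℚ b → a ℤ.≤ b
  toℚ-cancel-≤ {a} {b} le = ι-cancel-≤ (subst₂ _≤_ (toℚ≡ι a) (toℚ≡ι b) le)

  toℚ-^ : ∀ n m → toℚ (+ (n ℕ.^ m)) ≡ toℚ (+ n) ^ℚ m
  toℚ-^ n zero    = refl
  toℚ-^ n (suc m) = begin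
    toℚ (+ (n ℕ.* n ℕ.^ m))       ≡⟨ cong toℚ (ℤP.pos-* n (n ℕ.^ m)) ⟩
    toℚ (+ n ℤ.* + (n ℕ.^ m))     ≡⟨ toℚ-* (+ n) _ ⟩
    toℚ (+ n) * toℚ (+ (n ℕ.^ m)) ≡⟨ cong (toℚ (+ n) *_) (toℚ-^ n m) ⟩
    toℚ (+ n) * toℚ (+ n) ^ℚ m    ∎
    where open ≡-Reasoning

  toℚ-sumℤ : ∀ {n} (f : Fin n → ℤ) → toℚ (sumℤ f) ≡ sumℚ (λ j → toℚ (f j))
  toℚ-sumℤ {zero}  f = refl
  toℚ-sumℤ {suc n} f = trans (toℚ-+ (f zero) _) (cong (λ x → toℚ (f zero) + x) (toℚ-sumℤ (λ j → f (suc j))))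

  toℚ-signℤ : ∀ k → toℚ (signℤ k) ≡ signQ k
  toℚ-signℤ zero    = refl
  toℚ-signℤ (suc k) = trans (toℚ-neg (signℤ k)) (cong -_ (toℚ-signℤ k))

  toℚᴹ : ∀ {n} → Matrix n → MatrixQ n
  toℚᴹ M r c = toℚ (M r c)

  toℚ-det : ∀ {n} (M : Matrix n) → toℚ (det M) ≡ detQ (toℚᴹ M)
  toℚ-det {zero}  M = refl
  toℚ-det {suc n} M = begin
    toℚ (sumℤ (λ j → signℤ (toℕ j) ℤ.* (M zero j ℤ.* det (M′ j))))
      ≡⟨ toℚ-sumℤ (λ j → signℤ (toℕ j) ℤ.* (M zero j ℤ.* det (M′ j))) ⟩
    sumℚ (λ j → toℚ (signℤ (toℕ j) ℤ.* (M zero j ℤ.* det (M′ j))))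
      ≡⟨ sumℚ-cong term ⟩
    sumℚ (λ j → signQ (toℕ j) * (toℚ (M zero j) * detQ (minor (toℚᴹ M) j))) ∎
    where
    open ≡-Reasoning
    M′ : Fin (suc n) → Matrix n
    M′ j r c = M (suc r) (punchIn j c)
    term : ∀ j → toℚ (signℤ (toℕ j) ℤ.* (M zero j ℤ.* det (M′ j))) ≡ signQ (toℕ j) * (toℚ (M zero j) * detQ (minor (toℚᴹ M) j))
    term j = begin
      toℚ (signℤ (toℕ j) ℤ.* (M zero j ℤ.* det (M′ j)))              ≡⟨ toℚ-* (signℤ (toℕ j)) _ ⟩
      toℚ (signℤ (toℕ j)) * toℚ (M zero j ℤ.* det (M′ j))            ≡⟨ cong₂ _*_ (toℚ-signℤ (toℕ j)) (toℚ-* (M zero j) _) ⟩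
      signQ (toℕ j) * (toℚ (M zero j) * toℚ (det (M′ j)))            ≡⟨ cong (λ x → signQ (toℕ j) * (toℚ (M zero j) * x)) (toℚ-det (M′ j)) ⟩
      signQ (toℕ j) * (toℚ (M zero j) * detQ (minor (toℚᴹ M) j))     ∎

  toℚ-replaceCol : ∀ {n} (B : Matrix n) k (w : Fin n → ℤ) r j →
    toℚ (replaceCol B k w r j) ≡ setColumn (toℚᴹ B) k (λ i → toℚ (w i)) r j
  toℚ-replaceCol B k w r j with j ≟ k
  ... | yes _ = refl
  ... | no  _ = refl

module BarvinokStep where
  open Determinant
  open IntegerEmbedding
  open import Data.Integer as ℤ using (ℤ; +_)
  import Data.Integer.Properties as ℤP
  open import Data.Rational as ℚ using (ℚ; _+_; _*_; 1ℚ; _≤_; _<_)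
  import Data.Rational.Properties as ℚP
  open import Data.Rational.Solver using (module +-*-Solver)
  open +-*-Solver using (solve; _:=_; _:*_)

  toℚ-nonNeg : ∀ n → ℚ.NonNegative (toℚ (+ n))
  toℚ-nonNeg n = ℚ.nonNegative (toℚ-mono-≤ {+ 0} {+ n} (ℤ.+≤+ ℕ.z≤n))

  sumℚ-triangle : ∀ {n} (f : Fin n → ℚ) → ℚ.∣ sumℚ f ∣ ≤ sumℚ (λ j → ℚ.∣ f j ∣)
  sumℚ-triangle {zero}  f = ℚP.≤-refl
  sumℚ-triangle {suc n} f = ℚP.≤-trans (ℚP.∣p+q∣≤∣p∣+∣q∣ (f zero) _)
    (ℚP.+-monoʳ-≤ ℚ.∣ f zero ∣ (sumℚ-triangle (λ j → f (suc j))))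

  sumℚ-mono-≤ : ∀ {n} {f g : Fin n → ℚ} → (∀ j → f j ≤ g j) → sumℚ f ≤ sumℚ g
  sumℚ-mono-≤ {zero}  f≤g = ℚP.≤-refl
  sumℚ-mono-≤ {suc n} f≤g = ℚP.+-mono-≤ (f≤g zero) (sumℚ-mono-≤ (λ j → f≤g (suc j)))

  sumℚ-const : ∀ n E → sumℚ {n} (λ _ → toℚ (+ E)) ≡ toℚ (+ (n ℕ.* E))
  sumℚ-const zero    E = refl
  sumℚ-const (suc n) E = trans (cong (λ x → toℚ (+ E) + x) (sumℚ-const n E)) (sym (toℚ-+ (+ E) (+ (n ℕ.* E))))

  ^ℚ-distribʳ-* : ∀ p q k → (p * q) ^ℚ k ≡ (p ^ℚ k) * (q ^ℚ k)
  ^ℚ-distribʳ-* p q zero    = refl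
  ^ℚ-distribʳ-* p q (suc k) = trans (cong ((p * q) *_) (^ℚ-distribʳ-* p q k))
    (solve 4 (λ p q a b → (p :* q) :* (a :* b) := (p :* a) :* (q :* b)) refl p q (p ^ℚ k) (q ^ℚ k))

  module _ {p : ℚ} (1≤p : 1ℚ ≤ p) where
    private instance
      p-nonNeg : ℚ.NonNegative p
      p-nonNeg = ℚ.nonNegative (ℚP.≤-trans (ℚP.nonNegative⁻¹ 1ℚ) 1≤p)

    mutual
      1≤p⇒1≤p^n : ∀ n → 1ℚ ≤ p ^ℚ n
      1≤p⇒1≤p^n zero    = ℚP.≤-refl
      1≤p⇒1≤p^n (suc n) = ℚP.≤-trans 1≤p (1≤p⇒p≤p^[1+n] n)

      1≤p⇒p≤p^[1+n] : ∀ n → p ≤ p ^ℚ suc n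
      1≤p⇒p≤p^[1+n] n = subst (_≤ p ^ℚ suc n) (ℚP.*-identityʳ p) (ℚP.*-monoˡ-≤-nonNeg p (1≤p⇒1≤p^n n))

  p^[1+n]*q≤1⇒p≤1 : ∀ n {p q} → 1ℚ ≤ q → p ^ℚ suc n * q ≤ 1ℚ → p ≤ 1ℚ
  p^[1+n]*q≤1⇒p≤1 n {p} {q} 1≤q p^[1+n]*q≤1 with p ℚP.≤? 1ℚ
  ... | yes p≤1 = p≤1
  ... | no  p≰1 = ⊥-elim (ℚP.<-irrefl refl (begin-strict
    1ℚ              <⟨ 1<p ⟩
    p               ≤⟨ 1≤p⇒p≤p^[1+n] (ℚP.<⇒≤ 1<p) n ⟩
    p ^ℚ suc n      ≡⟨ ℚP.*-identityʳ (p ^ℚ suc n) ⟨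
    p ^ℚ suc n * 1ℚ ≤⟨ ℚP.*-monoˡ-≤-nonNeg (p ^ℚ suc n) {{p^[1+n]-nonNeg}} 1≤q ⟩
    p ^ℚ suc n * q  ≤⟨ p^[1+n]*q≤1 ⟩
    1ℚ              ∎))
    where
    open ℚP.≤-Reasoning
    1<p : 1ℚ < p
    1<p = ℚP.≰⇒> p≰1
    p^[1+n]-nonNeg : ℚ.NonNegative (p ^ℚ suc n)
    p^[1+n]-nonNeg = ℚ.nonNegative (ℚP.≤-trans (ℚP.nonNegative⁻¹ 1ℚ) (1≤p⇒1≤p^n (ℚP.<⇒≤ 1<p) (suc n)))

  combination-entries-≤ : ∀ {n} (B : Matrix n) (α : Fin n → ℚ) (w : Fin n → ℤ) E →
    (∀ i → toℚ (w i) ≡ sumℚ (λ j → toℚ (B i j) * α j)) → (∀ j → ℚ.∣ α j ∣ ≤ 1ℚ) →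
    (∀ i j → ℤ.∣ B i j ∣ ℕ.≤ E) → ∀ i → ℤ.∣ w i ∣ ℕ.≤ n ℕ.* E
  combination-entries-≤ {n} B α w E w≡Bα α≤1 B≤E i = ℤP.drop‿+≤+ (toℚ-cancel-≤ {+ ℤ.∣ w i ∣} {+ (n ℕ.* E)} (begin
    toℚ (+ ℤ.∣ w i ∣)                          ≡⟨ toℚ-∣∣ (w i) ⟨
    ℚ.∣ toℚ (w i) ∣                            ≡⟨ cong ℚ.∣_∣ (w≡Bα i) ⟩
    ℚ.∣ sumℚ (λ j → toℚ (B i j) * α j) ∣       ≤⟨ sumℚ-triangle (λ j → toℚ (B i j) * α j) ⟩
    sumℚ (λ j → ℚ.∣ toℚ (B i j) * α j ∣)       ≤⟨ sumℚ-mono-≤ term≤E ⟩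
    sumℚ {n} (λ _ → toℚ (+ E))                 ≡⟨ sumℚ-const n E ⟩
    toℚ (+ (n ℕ.* E))                          ∎))
    where
    open ℚP.≤-Reasoning
    term≤E : ∀ j → ℚ.∣ toℚ (B i j) * α j ∣ ≤ toℚ (+ E)
    term≤E j = begin
      ℚ.∣ toℚ (B i j) * α j ∣               ≡⟨ ℚP.∣p*q∣≡∣p∣*∣q∣ (toℚ (B i j)) (α j) ⟩
      ℚ.∣ toℚ (B i j) ∣ * ℚ.∣ α j ∣         ≡⟨ cong (_* ℚ.∣ α j ∣) (toℚ-∣∣ (B i j)) ⟩
      toℚ (+ ℤ.∣ B i j ∣) * ℚ.∣ α j ∣       ≤⟨ ℚP.*-monoʳ-≤-nonNeg ℚ.∣ α j ∣ {{ℚP.∣-∣-nonNeg (α j)}} (toℚ-mono-≤ (ℤ.+≤+ (B≤E i j))) ⟩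
      toℚ (+ E) * ℚ.∣ α j ∣                 ≤⟨ ℚP.*-monoˡ-≤-nonNeg (toℚ (+ E)) {{toℚ-nonNeg E}} (α≤1 j) ⟩
      toℚ (+ E) * 1ℚ                        ≡⟨ ℚP.*-identityʳ (toℚ (+ E)) ⟩
      toℚ (+ E)                             ∎

  barvinokVector-entries-≤ : ∀ {d} (B : Matrix (suc d)) {w} → 1 ℕ.≤ ℤ.∣ det B ∣ → IsBarvinokVector B w →
    ∀ E → (∀ i j → ℤ.∣ B i j ∣ ℕ.≤ E) → ∀ i → ℤ.∣ w i ∣ ℕ.≤ suc d ℕ.* E
  barvinokVector-entries-≤ {d} B {w} 1≤D (α , w≡Bα , α-short) E =
    combination-entries-≤ B α w E w≡Bα
      (λ j → p^[1+n]*q≤1⇒p≤1 d (toℚ-mono-≤ {+ 1} (ℤ.+≤+ 1≤D)) (α-short j))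

  barvinokVector-det-≤ : ∀ {d} (B : Matrix (suc d)) {w} → IsBarvinokVector B w → ∀ k →
    ℤ.∣ det (replaceCol B k w) ∣ ℕ.^ suc d ℕ.≤ ℤ.∣ det B ∣ ℕ.^ d
  barvinokVector-det-≤ {d} B {w} (α , w≡Bα , α-short) k =
    ℤP.drop‿+≤+ (toℚ-cancel-≤ {+ (D′ ℕ.^ suc d)} {+ (D ℕ.^ d)} (begin
      toℚ (+ (D′ ℕ.^ suc d))                       ≡⟨ toℚ-^ D′ (suc d) ⟩
      toℚ (+ D′) ^ℚ suc d                          ≡⟨ cong (_^ℚ suc d) D′≡∣αₖ∣D ⟩
      (ℚ.∣ α k ∣ * toℚ (+ D)) ^ℚ suc d             ≡⟨ ^ℚ-distribʳ-* ℚ.∣ α k ∣ (toℚ (+ D)) (suc d) ⟩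
      ℚ.∣ α k ∣ ^ℚ suc d * (toℚ (+ D) * toℚ (+ D) ^ℚ d)
        ≡⟨ ℚP.*-assoc (ℚ.∣ α k ∣ ^ℚ suc d) (toℚ (+ D)) (toℚ (+ D) ^ℚ d) ⟨
      ℚ.∣ α k ∣ ^ℚ suc d * toℚ (+ D) * toℚ (+ D) ^ℚ d
        ≡⟨ cong (ℚ.∣ α k ∣ ^ℚ suc d * toℚ (+ D) *_) (toℚ-^ D d) ⟨
      ℚ.∣ α k ∣ ^ℚ suc d * toℚ (+ D) * toℚ (+ (D ℕ.^ d))
        ≤⟨ ℚP.*-monoʳ-≤-nonNeg (toℚ (+ (D ℕ.^ d))) {{toℚ-nonNeg (D ℕ.^ d)}} (α-short k) ⟩
      1ℚ * toℚ (+ (D ℕ.^ d))                       ≡⟨ ℚP.*-identityˡ (toℚ (+ (D ℕ.^ d))) ⟩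
      toℚ (+ (D ℕ.^ d))                            ∎))
    where
    open ℚP.≤-Reasoning
    B′ = replaceCol B k w
    D = ℤ.∣ det B ∣
    D′ = ℤ.∣ det B′ ∣

    det-B′ : toℚ (det B′) ≡ α k * toℚ (det B)
    det-B′ = begin-equality
      toℚ (det B′)                                        ≡⟨ toℚ-det B′ ⟩
      detQ (toℚᴹ B′)                                      ≡⟨ detQ-cong (toℚ-replaceCol B k w) ⟩
      detQ (setColumn (toℚᴹ B) k (λ i → toℚ (w i)))       ≡⟨ cramer (toℚᴹ B) α k _ w≡Bα ⟩
      α k * detQ (toℚᴹ B)                                 ≡⟨ cong (α k *_) (toℚ-det B) ⟨
      α k * toℚ (det B)                                   ∎

    D′≡∣αₖ∣D : toℚ (+ D′) ≡ ℚ.∣ α k ∣ * toℚ (+ D)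
    D′≡∣αₖ∣D = begin-equality
      toℚ (+ D′)                        ≡⟨ toℚ-∣∣ (det B′) ⟨
      ℚ.∣ toℚ (det B′) ∣                ≡⟨ cong ℚ.∣_∣ det-B′ ⟩
      ℚ.∣ α k * toℚ (det B) ∣           ≡⟨ ℚP.∣p*q∣≡∣p∣*∣q∣ (α k) (toℚ (det B)) ⟩
      ℚ.∣ α k ∣ * ℚ.∣ toℚ (det B) ∣     ≡⟨ cong (ℚ.∣ α k ∣ *_) (toℚ-∣∣ (det B)) ⟩
      ℚ.∣ α k ∣ * toℚ (+ D)             ∎

open BarvinokStep using (barvinokVector-entries-≤; barvinokVector-det-≤)
open import Data.Nat using (_≤_; _<_; _^_; _*_; z≤n)
open import Data.Integer as ℤ using (ℤ)

iterated-power-≤ : ∀ {x y z} a b m → x ^ a ≤ y ^ b → y ^ (a ^ m) ≤ z ^ (b ^ m) →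
  x ^ (a ^ suc m) ≤ z ^ (b ^ suc m)
iterated-power-≤ {x} {y} {z} a b m x^a≤y^b y≤z = begin
  x ^ (a * a ^ m)    ≡⟨ ℕP.^-*-assoc x a (a ^ m) ⟨
  (x ^ a) ^ (a ^ m)  ≤⟨ ℕP.^-monoˡ-≤ (a ^ m) x^a≤y^b ⟩
  (y ^ b) ^ (a ^ m)  ≡⟨ ℕP.^-*-assoc y b (a ^ m) ⟩
  y ^ (b * a ^ m)    ≡⟨ cong (y ^_) (ℕP.*-comm b (a ^ m)) ⟩
  y ^ (a ^ m * b)    ≡⟨ ℕP.^-*-assoc y (a ^ m) b ⟨
  (y ^ (a ^ m)) ^ b  ≤⟨ ℕP.^-monoˡ-≤ b y≤z ⟩
  (z ^ (b ^ m)) ^ b  ≡⟨ ℕP.^-*-assoc z (b ^ m) b ⟩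
  z ^ (b ^ m * b)    ≡⟨ cong (z ^_) (ℕP.*-comm (b ^ m) b) ⟩
  z ^ (b * b ^ m)    ∎
  where open ℕP.≤-Reasoning

level<k : ∀ {y z} a b {m k} → m ≤ k → 2 ≤ y → y ^ (a ^ m) ≤ z ^ (b ^ m) → z ^ (b ^ k) < 2 ^ (a ^ k) → m < k
level<k {y} {z} a b {m} m≤k 2≤y y≤z z<2 = ℕP.≤∧≢⇒< m≤k m≢k
  where
  m≢k : m ≢ _
  m≢k refl = ℕP.<-irrefl refl (ℕP.≤-<-trans (ℕP.≤-trans (ℕP.^-monoˡ-≤ (a ^ m) 2≤y) y≤z) z<2)

replaceCol-entries-≤ : ∀ {d} (B : Matrix d) k w {E} → (∀ i j → ℤ.∣ B i j ∣ ≤ E) → (∀ i → ℤ.∣ w i ∣ ≤ E) →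
  ∀ i j → ℤ.∣ replaceCol B k w i j ∣ ≤ E
replaceCol-entries-≤ B k w B≤E w≤E i j with j ≟ k
... | yes _ = w≤E i
... | no  _ = B≤E i j

appears-entries-≤ : ∀ d′ C k D → D ^ (d′ ^ k) < 2 ^ (suc d′ ^ k) →
  ∀ (B : Matrix (suc d′)) m → m ≤ k → (∀ i j → ℤ.∣ B i j ∣ ≤ suc d′ ^ m * C) →
  ℤ.∣ det B ∣ ^ (suc d′ ^ m) ≤ D ^ (d′ ^ m) →
  ∀ B̄ → Appears B B̄ → ∀ i j → ℤ.∣ B̄ i j ∣ ≤ suc d′ ^ k * C
appears-entries-≤ d′ C k D k-bound B m m≤k B≤dᵐC invariant .B root i j =
  ℕP.≤-trans (B≤dᵐC i j) (ℕP.*-monoˡ-≤ C (ℕP.^-monoʳ-≤ (suc d′) m≤k))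
appears-entries-≤ d′ C k D k-bound B m m≤k B≤dᵐC invariant B̄ (step w k′ 1<∣detB∣ bv _ B̄-below) =
  appears-entries-≤ d′ C k D k-bound (replaceCol B k′ w) (suc m)
    (level<k (suc d′) d′ m≤k 1<∣detB∣ invariant k-bound)
    (replaceCol-entries-≤ B k′ w B≤dᵐ⁺¹C w≤dᵐ⁺¹C)
    (iterated-power-≤ (suc d′) d′ m (barvinokVector-det-≤ B bv k′) invariant)
    B̄ B̄-below
  where
  dᵐC≤dᵐ⁺¹C : suc d′ ^ m * C ≤ suc d′ ^ suc m * C
  dᵐC≤dᵐ⁺¹C = ℕP.*-monoˡ-≤ C (ℕP.^-monoʳ-≤ (suc d′) (ℕP.n≤1+n m))
  B≤dᵐ⁺¹C : ∀ i j → ℤ.∣ B i j ∣ ≤ suc d′ ^ suc m * C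
  B≤dᵐ⁺¹C i j = ℕP.≤-trans (B≤dᵐC i j) dᵐC≤dᵐ⁺¹C
  w≤dᵐ⁺¹C : ∀ i → ℤ.∣ w i ∣ ≤ suc d′ ^ suc m * C
  w≤dᵐ⁺¹C i = subst (ℤ.∣ w i ∣ ≤_) (sym (ℕP.*-assoc (suc d′) (suc d′ ^ m) C))
    (barvinokVector-entries-≤ B {w} (ℕP.<⇒≤ 1<∣detB∣) bv (suc d′ ^ m * C) B≤dᵐC i)

lemma4p2 : (d : ℕ) → 2 ≤ d → (B : Matrix d) → 1 ≤ ℤ.∣ det B ∣ →
    (C : ℕ) → (∀ i j → ℤ.∣ B i j ∣ ≤ C) →
    (k : ℕ) → IsKD d ℤ.∣ det B ∣ k →
    ∀ B̄ → Appears B B̄ → ∀ i j → ℤ.∣ B̄ i j ∣ ≤ d ^ k * C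
lemma4p2 (suc d′) _ B _ C B≤C k (_ , k-bound) =
  appears-entries-≤ d′ C k ℤ.∣ det B ∣ k-bound B 0 z≤n
    (λ i j → subst (ℤ.∣ B i j ∣ ≤_) (sym (ℕP.*-identityˡ C)) (B≤C i j)) ℕP.≤-refl
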